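{- Let $G$ be a graph none of whose connected components is a clique, and let $k\in\mathbb{N}$. Partition $V(\mathrm{CC}(G)) = A \,\dot\cup\, B$ where a critical clique $x$ is in $A$ iff $\mathrm{CC}(G)[N_{\mathrm{CC}(G)}(x)]$ is a clique. Let $\overline{A} := \bigcup_{x\in A} x$ and $\overline{B} := \bigcup_{x\in B} x$ (so $V(G)=\overline{A}\,\dot\cup\,\overline{B}$). If $|A| = |\overline{A}|$ and $|V(G)| > 3k$, then $(G, |V(G)|+k)$ is a no-instance of \textsc{Sigma Clique Cover}.
   Context: Graphs are finite, simple, undirected. A \emph{sigma clique cover} of $G$ is a set $\mathcal{C}$ of subsets of $V(G)$ such that $G[C]$ is a clique for every $C\in\mathcal{C}$ and every edge of $G$ has both endpoints in some $C\in\mathcal{C}$; its weight is $\sum_{C\in\mathcal{C}}|C|$. \textsc{Sigma Clique Cover}: given $(G,s)$, decide whether $G$ has a sigma clique cover of weight at most $s$. Let $R_G$ be the equivalence relation on $V(G)$ with $(v,w)\in R_G$ iff $N(v)\cup\{v\}=N(w)\cup\{w\}$; the classes $[v]_G$ are the \emph{critical cliques}. The \emph{critical clique graph} $\mathrm{CC}(G)$ has vertex set $\{[v]_G : v\in V(G)\}$ and edge set $\{[v]_G[w]_G : vw\in E(G),\ [v]_G\ne[w]_G\}$. -}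

module Defs where

open import Data.Nat using (ℕ; zero; suc; _+_; _≤ᵇ_)
open import Data.Bool using (Bool; true; false; _∧_; _∨_; not; if_then_else_)
open import Data.Fin using (Fin; zero; suc; toℕ; _≟_)
open import Data.Fin.Subset using (Subset; _∈_; ∣_∣)
open import Data.List using (List; map)
open import Data.Nat.ListAction using (sum)
open import Data.List.Relation.Unary.All using (All)
open import Data.List.Relation.Unary.Any using (Any)
open import Data.Product using (Σ; _×_; ∃-syntax)
open import Relation.Nullary using (¬_)
open import Relation.Nullary.Decidable using (⌊_⌋)
open import Relation.Binary.PropositionalEquality using (_≡_; _≢_)

record Graph (n : ℕ) : Set where
  field
    adj   : Fin n → Fin n → Bool
    sym   : ∀ u v → adj u v ≡ adj v u
    irrefl : ∀ v → adj v v ≡ false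
open Graph public

allF : ∀ {n} → (Fin n → Bool) → Bool
allF {zero}  f = true
allF {suc n} f = f zero ∧ allF (λ i → f (suc i))

anyF : ∀ {n} → (Fin n → Bool) → Bool
anyF {zero}  f = false
anyF {suc n} f = f zero ∨ anyF (λ i → f (suc i))

countF : ∀ {n} → (Fin n → Bool) → ℕ
countF {zero}  f = 0
countF {suc n} f = (if f zero then 1 else 0) + countF (λ i → f (suc i))

_⇔ᵇ_ : Bool → Bool → Bool
a ⇔ᵇ b = (a ∧ b) ∨ (not a ∧ not b)

_⇒ᵇ_ : Bool → Bool → Bool
a ⇒ᵇ b = not a ∨ b

eqF : ∀ {n} → Fin n → Fin n → Bool
eqF u v = ⌊ u ≟ v ⌋

module _ {n : ℕ} (G : Graph n) where

  IsClique : Subset n → Set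
  IsClique C = ∀ u v → u ∈ C → v ∈ C → u ≢ v → adj G u v ≡ true

  record SigmaCliqueCover : Set where
    field
      sets    : List (Subset n)
      cliques : All IsClique sets
      covers  : ∀ u v → adj G u v ≡ true → Any (λ C → u ∈ C × v ∈ C) sets
  open SigmaCliqueCover public

  weight : SigmaCliqueCover → ℕ
  weight 𝒞 = sum (map ∣_∣ (sets 𝒞))

  HasSigmaCliqueCover : ℕ → Set
  HasSigmaCliqueCover s = Σ SigmaCliqueCover (λ 𝒞 → weight 𝒞 Data.Nat.≤ s)

  data Reach (u : Fin n) : Fin n → Set where
    here : Reach u u
    step : ∀ {v w} → Reach u v → adj G v w ≡ true → Reach u w

  ComponentNotClique : Fin n → Set
  ComponentNotClique v =
    ∃[ a ] ∃[ b ] (Reach v a × Reach v b × a ≢ b × adj G a b ≡ false)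

  NoComponentIsClique : Set
  NoComponentIsClique = ∀ v → ComponentNotClique v

  -- Critical cliques.  R_G v w  iff  N[v] = N[w].

  closedNbr : Fin n → Fin n → Bool
  closedNbr v u = eqF u v ∨ adj G v u

  sameCC : Fin n → Fin n → Bool
  sameCC v w = allF (λ u → closedNbr v u ⇔ᵇ closedNbr w u)

  -- A vertex of CC(G) (a class [v]_G)
  -- is referred to by any representative v ∈ V(G).
  -- [v][w] ∈ E(CC(G))  iff  [v] ≠ [w] and some v' ∈ [v], w' ∈ [w] are adjacent.
  ccAdj : Fin n → Fin n → Bool
  ccAdj v w = not (sameCC v w) ∧
    anyF (λ v' → anyF (λ w' → sameCC v v' ∧ sameCC w w' ∧ adj G v' w'))

  inA : Fin n → Bool
  inA v = allF (λ y → allF (λ z →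
    (ccAdj v y ∧ ccAdj v z ∧ not (sameCC y z)) ⇒ᵇ ccAdj y z))

  -- |A̅| : number of vertices of G lying in a critical clique of A
  sizeAbar : ℕ
  sizeAbar = countF inA

  isCanonical : Fin n → Bool
  isCanonical v = allF (λ w → sameCC v w ⇒ᵇ (toℕ v ≤ᵇ toℕ w))

  -- |A| : number of critical cliques in A (counted via canonical representatives)
  sizeA : ℕ
  sizeA = countF (λ v → inA v ∧ isCanonical v)

{-# OPTIONS --safe #-}
-- A critical clique in A is simplicial. It is counted once in |A| but with all its
-- vertices in |Ā|, so |A| = |Ā| makes every class in A a single vertex; hence A is an
-- independent set and a clique meets it at most once.
-- Charge every clique C of size at least 2 in a cover 2 for each of its vertices and 2
-- more for its vertex in A, if any: at most 3|C| in total. A vertex of A is not isolated,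
-- so it lies in such a clique and collects 4; any other vertex has two non-adjacent
-- neighbours, lies in two different such cliques and collects 2 + 2. Hence
-- 4|V| ≤ 3 · weight, while weight ≤ |V| + k < 4|V|/3.
module Submission where

open import Defs hiding (sym)
open import Data.Nat using (ℕ; _+_; _*_; _<_)
open import Relation.Nullary using (¬_)
open import Relation.Binary.PropositionalEquality using (_≡_)

open import Data.Nat using (zero; suc; _≤_; z≤n; s≤s; _≤ᵇ_)
open import Data.Nat.Properties
  using (≤-reflexive; ≤-trans; ≤-antisym; +-mono-≤; +-monoʳ-≤; +-monoʳ-<; *-monoʳ-≤; m≤m+n; m≤n+m;
         m≤n⇒m≤1+n; +-comm; *-comm; *-identityˡ; *-distribˡ-+; suc-injective; <-irrefl;
         ≤ᵇ⇒≤; ≤⇒≤ᵇ; +-*-semiring; module ≤-Reasoning)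
open import Data.Bool using (Bool; true; false; _∧_; _∨_; not; if_then_else_; T)
open import Data.Bool.Properties using (¬-not) renaming (_≟_ to _≟ᵇ_)
open import Data.Fin using (Fin; zero; suc; toℕ; _≟_)
open import Data.Fin.Properties using (toℕ-injective) renaming (suc-injective to Fin-suc-injective)
open import Data.Fin.Subset using (Subset; _∈_; ∣_∣)
open import Data.Vec using ([]; _∷_; lookup)
open import Data.Vec.Properties using ([]=⇒lookup; lookup⇒[]=)
open import Data.List using (List; []; _∷_; map)
open import Data.Nat.ListAction using (sum)
open import Data.List.Relation.Unary.All using (All; []; _∷_)
open import Data.List.Relation.Unary.Any using (Any; here; there)
open import Data.Product using (_×_; _,_; ∃-syntax)
open import Data.Sum using (_⊎_; inj₁; inj₂)
open import Data.Empty using (⊥; ⊥-elim)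
open import Data.Unit using (tt)
open import Function using (_∘_)
open import Relation.Nullary using (yes; no)
open import Relation.Binary.PropositionalEquality
  using (_≢_; _≗_; refl; sym; trans; cong; cong₂; subst; module ≡-Reasoning)
open import Algebra.Properties.Semiring.Sum +-*-semiring
  using (sum-syntax; sum-replicate-zero; ∑-distrib-+; *-distribˡ-sum)

∧-intro : ∀ {a b} → a ≡ true → b ≡ true → a ∧ b ≡ true
∧-intro refl refl = refl

∧-elimˡ : ∀ {a b} → a ∧ b ≡ true → a ≡ true
∧-elimˡ {true} _ = refl

∧-elimʳ : ∀ {a b} → a ∧ b ≡ true → b ≡ true
∧-elimʳ {true} e = e

∨-introˡ : ∀ {a b} → a ≡ true → a ∨ b ≡ true
∨-introˡ refl = refl

∨-introʳ : ∀ {a b} → b ≡ true → a ∨ b ≡ true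
∨-introʳ {true} _ = refl
∨-introʳ {false} e = e

∨-elim : ∀ {a b} → a ∨ b ≡ true → a ≡ true ⊎ b ≡ true
∨-elim {true} _ = inj₁ refl
∨-elim {false} e = inj₂ e

not-true : ∀ {a} → not a ≡ true → a ≡ false
not-true {false} _ = refl

not-false : ∀ {a} → a ≡ false → not a ≡ true
not-false refl = refl

⇒ᵇ-elim : ∀ {a b} → a ⇒ᵇ b ≡ true → a ≡ true → b ≡ true
⇒ᵇ-elim {true} e refl = e

⇒ᵇ-false : ∀ {a b} → a ⇒ᵇ b ≡ false → a ≡ true × b ≡ false
⇒ᵇ-false {true} {false} _ = refl , refl

⇔ᵇ-elim : ∀ {a b} → a ⇔ᵇ b ≡ true → a ≡ b
⇔ᵇ-elim {true} {true} _ = refl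
⇔ᵇ-elim {false} {false} _ = refl

⇔ᵇ-intro : ∀ {a b} → a ≡ b → a ⇔ᵇ b ≡ true
⇔ᵇ-intro {true} refl = refl
⇔ᵇ-intro {false} refl = refl

true≢false : ∀ {a} → a ≡ true → a ≡ false → ⊥
true≢false refl ()

Bool-ext : ∀ {a b} → (a ≡ true → b ≡ true) → (b ≡ true → a ≡ true) → a ≡ b
Bool-ext {true} {true} _ _ = refl
Bool-ext {false} {false} _ _ = refl
Bool-ext {true} {false} f _ = sym (f refl)
Bool-ext {false} {true} _ g = g refl

T⇒≡true : ∀ {a} → T a → a ≡ true
T⇒≡true {true} _ = refl

≡true⇒T : ∀ {a} → a ≡ true → T a
≡true⇒T refl = tt

eqF-refl : ∀ {n} (x : Fin n) → eqF x x ≡ true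
eqF-refl x with x ≟ x
... | yes _ = refl
... | no x≢x = ⊥-elim (x≢x refl)

eqF⇒≡ : ∀ {n} {x y : Fin n} → eqF x y ≡ true → x ≡ y
eqF⇒≡ {x = x} {y} e with x ≟ y
... | yes x≡y = x≡y

allF⇒∀ : ∀ {n} {f : Fin n → Bool} → allF f ≡ true → ∀ i → f i ≡ true
allF⇒∀ e zero = ∧-elimˡ e
allF⇒∀ {f = f} e (suc i) = allF⇒∀ {f = λ i → f (suc i)} (∧-elimʳ {f zero} e) i

∀⇒allF : ∀ {n} {f : Fin n → Bool} → (∀ i → f i ≡ true) → allF f ≡ true
∀⇒allF {zero} h = refl
∀⇒allF {suc n} h = ∧-intro (h zero) (∀⇒allF (λ i → h (suc i)))

allF-false⇒∃ : ∀ {n} {f : Fin n → Bool} → allF f ≡ false → ∃[ i ] f i ≡ false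
allF-false⇒∃ {suc n} {f} e with f zero in f0
... | false = zero , f0
... | true with allF-false⇒∃ {f = λ i → f (suc i)} e
...   | i , fi = suc i , fi

∃⇒anyF : ∀ {n} {f : Fin n → Bool} i → f i ≡ true → anyF f ≡ true
∃⇒anyF zero e = ∨-introˡ e
∃⇒anyF {f = f} (suc i) e = ∨-introʳ {f zero} (∃⇒anyF {f = λ i → f (suc i)} i e)

anyF⇒∃ : ∀ {n} {f : Fin n → Bool} → anyF f ≡ true → ∃[ i ] f i ≡ true
anyF⇒∃ {suc n} {f} e with ∨-elim {f zero} e
... | inj₁ f0 = zero , f0
... | inj₂ rest with anyF⇒∃ {f = λ i → f (suc i)} rest
...   | i , fi = suc i , fi

ind : Bool → ℕ
ind b = if b then 1 else 0

countF≡∑ : ∀ {n} (f : Fin n → Bool) → countF f ≡ ∑[ i < n ] ind (f i)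
countF≡∑ {zero} f = refl
countF≡∑ {suc n} f = cong (ind (f zero) +_) (countF≡∑ (λ i → f (suc i)))

∣p∣≡countF : ∀ {n} (p : Subset n) → ∣ p ∣ ≡ countF (lookup p)
∣p∣≡countF [] = refl
∣p∣≡countF (true ∷ p) = cong suc (∣p∣≡countF p)
∣p∣≡countF (false ∷ p) = ∣p∣≡countF p

countF≥1 : ∀ {n} {f : Fin n → Bool} i → f i ≡ true → 1 ≤ countF f
countF≥1 zero e rewrite e = s≤s z≤n
countF≥1 {f = f} (suc i) e = ≤-trans (countF≥1 {f = λ i → f (suc i)} i e) (m≤n+m _ (ind (f zero)))

countF≥2 : ∀ {n} {f : Fin n → Bool} i j → f i ≡ true → f j ≡ true → i ≢ j → 2 ≤ countF f
countF≥2 zero zero _ _ i≢j = ⊥-elim (i≢j refl)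
countF≥2 {f = f} zero (suc j) fi fj _ rewrite fi = s≤s (countF≥1 {f = λ i → f (suc i)} j fj)
countF≥2 {f = f} (suc i) zero fi fj _ rewrite fj = s≤s (countF≥1 {f = λ i → f (suc i)} i fi)
countF≥2 {f = f} (suc i) (suc j) fi fj i≢j =
  ≤-trans (countF≥2 {f = λ i → f (suc i)} i j fi fj (λ i≡j → i≢j (cong suc i≡j))) (m≤n+m _ (ind (f zero)))

countF≡0 : ∀ {n} {f : Fin n → Bool} → (∀ i → f i ≡ false) → countF f ≡ 0
countF≡0 {zero} h = refl
countF≡0 {suc n} {f} h rewrite h zero = countF≡0 {f = λ i → f (suc i)} (λ i → h (suc i))

countF≤1 : ∀ {n} {f : Fin n → Bool} → (∀ i j → f i ≡ true → f j ≡ true → i ≡ j) → countF f ≤ 1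
countF≤1 {zero} h = z≤n
countF≤1 {suc n} {f} h with f zero in f0
... | true = s≤s (≤-reflexive (countF≡0 {f = λ i → f (suc i)} rest-false))
  where
  rest-false : ∀ i → f (suc i) ≡ false
  rest-false i with f (suc i) in fi
  ... | false = refl
  ... | true with () ← h zero (suc i) f0 fi
... | false = countF≤1 {f = λ i → f (suc i)} (λ i j fi fj → Fin-suc-injective (h (suc i) (suc j) fi fj))

countF-mono : ∀ {n} {f g : Fin n → Bool} → (∀ i → f i ≡ true → g i ≡ true) → countF f ≤ countF g
countF-mono {zero} h = z≤n
countF-mono {suc n} {f} {g} h with f zero in f0 | g zero in g0
... | true | true = s≤s (countF-mono (λ i → h (suc i)))
... | false | true = m≤n⇒m≤1+n (countF-mono (λ i → h (suc i)))
... | false | false = countF-mono (λ i → h (suc i))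
... | true | false = ⊥-elim (true≢false (h zero f0) g0)

countF-≡⇒⊇ : ∀ {n} {f g : Fin n → Bool} → (∀ i → f i ≡ true → g i ≡ true) → countF f ≡ countF g →
             ∀ i → g i ≡ true → f i ≡ true
countF-≡⇒⊇ {suc n} {f} {g} f⊆g eq with f zero in f0 | g zero in g0
... | true | true = λ where
  zero _ → f0
  (suc i) → countF-≡⇒⊇ {f = λ i → f (suc i)} (λ i → f⊆g (suc i)) (suc-injective eq) i
... | false | false = λ where
  zero g0′ → ⊥-elim (true≢false g0′ g0)
  (suc i) → countF-≡⇒⊇ {f = λ i → f (suc i)} (λ i → f⊆g (suc i)) eq i
... | false | true = ⊥-elim (<-irrefl eq (s≤s (countF-mono {f = λ i → f (suc i)} (λ i → f⊆g (suc i)))))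
... | true | false = ⊥-elim (true≢false (f⊆g zero f0) g0)

∑-const : ∀ {n} c → ∑[ i < n ] c ≡ n * c
∑-const {zero} c = refl
∑-const {suc n} c = cong (c +_) (∑-const {n} c)

∑-mono-≤ : ∀ {n} {f g : Fin n → ℕ} → (∀ i → f i ≤ g i) → ∑[ i < n ] f i ≤ ∑[ i < n ] g i
∑-mono-≤ {zero} h = z≤n
∑-mono-≤ {suc n} h = +-mono-≤ (h zero) (∑-mono-≤ (λ i → h (suc i)))

sum-map-∑-comm : ∀ {A : Set} {n} (L : List A) (t : A → Fin n → ℕ) →
                 sum (map (λ C → ∑[ v < n ] t C v) L) ≡ ∑[ v < n ] sum (map (λ C → t C v) L)
sum-map-∑-comm {n = n} [] t = sym (sum-replicate-zero n)
sum-map-∑-comm {n = n} (C ∷ L) t = begin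
  ∑[ v < n ] t C v + sum (map (λ C → ∑[ v < n ] t C v) L)  ≡⟨ cong (∑[ v < n ] t C v +_) (sum-map-∑-comm L t) ⟩
  ∑[ v < n ] t C v + ∑[ v < n ] sum (map (λ C → t C v) L)  ≡⟨ sym (∑-distrib-+ (t C) _) ⟩
  ∑[ v < n ] (t C v + sum (map (λ C → t C v) L))           ∎
  where open ≡-Reasoning

≤-sum-map-Any : ∀ {A : Set} {P : A → Set} {L : List A} (f : A → ℕ) {m} →
                Any P L → (∀ {C} → P C → m ≤ f C) → m ≤ sum (map f L)
≤-sum-map-Any {L = C ∷ L} f (here p) bound = ≤-trans (bound p) (m≤m+n (f C) _)
≤-sum-map-Any {L = C ∷ L} f (there p) bound = ≤-trans (≤-sum-map-Any f p bound) (m≤n+m _ (f C))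

≤-sum-map-Any₂ : ∀ {A : Set} {R P Q : A → Set} {L : List A} (f : A → ℕ) {m₁ m₂} →
                 All R L → Any P L → Any Q L → (∀ {C} → R C → P C → Q C → ⊥) →
                 (∀ {C} → P C → m₁ ≤ f C) → (∀ {C} → Q C → m₂ ≤ f C) → m₁ + m₂ ≤ sum (map f L)
≤-sum-map-Any₂ f (r ∷ _) (here p) (here q) disjoint _ _ = ⊥-elim (disjoint r p q)
≤-sum-map-Any₂ f (_ ∷ _) (here p) (there q) _ bound₁ bound₂ =
  +-mono-≤ (bound₁ p) (≤-sum-map-Any f q bound₂)
≤-sum-map-Any₂ {L = C ∷ L} f {m₁} {m₂} (_ ∷ _) (there p) (here q) _ bound₁ bound₂ =
  subst (_≤ f C + sum (map f L)) (+-comm m₂ m₁) (+-mono-≤ (bound₂ q) (≤-sum-map-Any f p bound₁))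
≤-sum-map-Any₂ {L = C ∷ L} f (_ ∷ rs) (there p) (there q) disjoint bound₁ bound₂ =
  ≤-trans (≤-sum-map-Any₂ f rs p q disjoint bound₁ bound₂) (m≤n+m _ (f C))

sum-map-≤-* : ∀ {A : Set} {P : A → Set} {L : List A} (f g : A → ℕ) c →
              All P L → (∀ {C} → P C → f C ≤ c * g C) → sum (map f L) ≤ c * sum (map g L)
sum-map-≤-* f g c [] _ = z≤n
sum-map-≤-* {L = C ∷ L} f g c (p ∷ ps) bound =
  subst (f C + sum (map f L) ≤_) (sym (*-distribˡ-+ c (g C) (sum (map g L))))
        (+-mono-≤ (bound p) (sum-map-≤-* f g c ps bound))

-- Closed neighbourhoods, critical cliques and simplicial vertices

module _ {n : ℕ} (G : Graph n) where

  adj-sym : ∀ {x y} → adj G x y ≡ true → adj G y x ≡ true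
  adj-sym {x} {y} e = trans (Graph.sym G y x) e

  adj⇒≢ : ∀ {x y} → adj G x y ≡ true → x ≢ y
  adj⇒≢ {x} e refl = true≢false e (irrefl G x)

  closedNbr-refl : ∀ x → closedNbr G x x ≡ true
  closedNbr-refl x = ∨-introˡ (eqF-refl x)

  adj⇒closedNbr : ∀ {x u} → adj G x u ≡ true → closedNbr G x u ≡ true
  adj⇒closedNbr {x} {u} e = ∨-introʳ {eqF u x} e

  closedNbr⇒adj : ∀ {x u} → closedNbr G x u ≡ true → x ≢ u → adj G x u ≡ true
  closedNbr⇒adj {x} {u} e x≢u with ∨-elim {eqF u x} e
  ... | inj₁ u≡x = ⊥-elim (x≢u (sym (eqF⇒≡ u≡x)))
  ... | inj₂ xu = xu

  closedNbr-sym : ∀ {x u} → closedNbr G x u ≡ true → closedNbr G u x ≡ true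
  closedNbr-sym {x} {u} e with ∨-elim {eqF u x} e
  ... | inj₁ u≡x rewrite eqF⇒≡ u≡x = closedNbr-refl x
  ... | inj₂ xu = adj⇒closedNbr (adj-sym xu)

  sameCC⇒≗ : ∀ {x y} → sameCC G x y ≡ true → closedNbr G x ≗ closedNbr G y
  sameCC⇒≗ e u = ⇔ᵇ-elim (allF⇒∀ e u)

  ≗⇒sameCC : ∀ {x y} → closedNbr G x ≗ closedNbr G y → sameCC G x y ≡ true
  ≗⇒sameCC x≗y = ∀⇒allF (λ u → ⇔ᵇ-intro (x≗y u))

  sameCC-refl : ∀ x → sameCC G x x ≡ true
  sameCC-refl x = ≗⇒sameCC (λ _ → refl)

  sameCC-sym : ∀ {x y} → sameCC G x y ≡ true → sameCC G y x ≡ true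
  sameCC-sym e = ≗⇒sameCC (λ u → sym (sameCC⇒≗ e u))

  sameCC⇒adj : ∀ {x y} → sameCC G x y ≡ true → x ≢ y → adj G x y ≡ true
  sameCC⇒adj {x} {y} e = closedNbr⇒adj (trans (sameCC⇒≗ e y) (closedNbr-refl y))

  ccAdj⇒adj : ∀ {x y} → ccAdj G x y ≡ true → adj G x y ≡ true
  ccAdj⇒adj {x} {y} e with anyF⇒∃ (∧-elimʳ {not (sameCC G x y)} e)
  ... | x′ , e′ with anyF⇒∃ e′
  ... | y′ , x~x′∧y~y′∧x′y′ = closedNbr⇒adj (closedNbr-sym x∈N[y]) x≢y
    where
    x~x′ : sameCC G x x′ ≡ true
    x~x′ = ∧-elimˡ x~x′∧y~y′∧x′y′
    y~y′ : sameCC G y y′ ≡ true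
    y~y′ = ∧-elimˡ (∧-elimʳ {sameCC G x x′} x~x′∧y~y′∧x′y′)
    x′y′ : adj G x′ y′ ≡ true
    x′y′ = ∧-elimʳ {sameCC G y y′} (∧-elimʳ {sameCC G x x′} x~x′∧y~y′∧x′y′)
    x≢y : x ≢ y
    x≢y refl = true≢false (sameCC-refl x) (not-true (∧-elimˡ e))
    x∈N[y] : closedNbr G y x ≡ true
    x∈N[y] = trans (sameCC⇒≗ y~y′ x) (closedNbr-sym (trans (sameCC⇒≗ x~x′ y′) (adj⇒closedNbr x′y′)))

  adj⇒ccAdj : ∀ {x y} → sameCC G x y ≡ false → adj G x y ≡ true → ccAdj G x y ≡ true
  adj⇒ccAdj {x} {y} x≁y xy =
    ∧-intro (not-false x≁y) (∃⇒anyF x (∃⇒anyF y (∧-intro (sameCC-refl x) (∧-intro (sameCC-refl y) xy))))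

  Simplicial : Fin n → Set
  Simplicial v = ∀ y z → adj G v y ≡ true → adj G v z ≡ true → y ≢ z → adj G y z ≡ true

  inA⇒Simplicial : ∀ v → inA G v ≡ true → Simplicial v
  inA⇒Simplicial v v∈A y z vy vz y≢z with sameCC G y z in y~z | sameCC G v y in v~y | sameCC G v z in v~z
  ... | true | _ | _ = sameCC⇒adj y~z y≢z
  ... | false | true | _ = closedNbr⇒adj (trans (sym (sameCC⇒≗ v~y z)) (adj⇒closedNbr vz)) y≢z
  ... | false | false | true =
    adj-sym (closedNbr⇒adj (trans (sym (sameCC⇒≗ v~z y)) (adj⇒closedNbr vy)) (λ z≡y → y≢z (sym z≡y)))
  ... | false | false | false = ccAdj⇒adj (⇒ᵇ-elim (allF⇒∀ (allF⇒∀ v∈A y) z)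
    (∧-intro (adj⇒ccAdj v~y vy) (∧-intro (adj⇒ccAdj v~z vz) (not-false y~z))))

  NonAdjacentNeighbours : Fin n → Set
  NonAdjacentNeighbours v =
    ∃[ y ] ∃[ z ] (adj G v y ≡ true × adj G v z ≡ true × y ≢ z × adj G y z ≡ false)

  inA-false⇒NonAdjacentNeighbours : ∀ v → inA G v ≡ false → NonAdjacentNeighbours v
  inA-false⇒NonAdjacentNeighbours v v∉A with allF-false⇒∃ v∉A
  ... | y , e with allF-false⇒∃ e
  ... | z , e′ with ⇒ᵇ-false e′
  ... | vy∧vz∧y≁z , ¬yz = y , z , ccAdj⇒adj vy , ccAdj⇒adj vz , y≢z , ¬adj
    where
    vy : ccAdj G v y ≡ true
    vy = ∧-elimˡ vy∧vz∧y≁z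
    vz : ccAdj G v z ≡ true
    vz = ∧-elimˡ (∧-elimʳ {ccAdj G v y} vy∧vz∧y≁z)
    y≁z : sameCC G y z ≡ false
    y≁z = not-true (∧-elimʳ {ccAdj G v z} (∧-elimʳ {ccAdj G v y} vy∧vz∧y≁z))
    y≢z : y ≢ z
    y≢z refl = true≢false (sameCC-refl y) y≁z
    ¬adj : adj G y z ≡ false
    ¬adj = ¬-not (λ yz → true≢false (adj⇒ccAdj y≁z yz) ¬yz)

  Simplicial-adj⇒sameCC : ∀ {v w} → Simplicial v → Simplicial w → adj G v w ≡ true → sameCC G v w ≡ true
  Simplicial-adj⇒sameCC {v} {w} sv sw vw =
    ≗⇒sameCC (λ u → Bool-ext (N[v]⊆N[w] sv vw u) (N[v]⊆N[w] sw (adj-sym vw) u))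
    where
    N[v]⊆N[w] : ∀ {v w} → Simplicial v → adj G v w ≡ true → ∀ u → closedNbr G v u ≡ true → closedNbr G w u ≡ true
    N[v]⊆N[w] {v} {w} sv vw u u∈N[v] with v ≟ u | w ≟ u
    ... | yes refl | _ = adj⇒closedNbr (adj-sym vw)
    ... | no _ | yes refl = closedNbr-refl w
    ... | no v≢u | no w≢u = adj⇒closedNbr (adj-sym (sv u w (closedNbr⇒adj u∈N[v] v≢u) vw (λ u≡w → w≢u (sym u≡w))))

  Reach⇒neighbour : ∀ {v a} → Reach G v a → v ≢ a → ∃[ u ] adj G v u ≡ true
  Reach⇒neighbour here v≢v = ⊥-elim (v≢v refl)
  Reach⇒neighbour {v} (step {x} {a} r xa) v≢a with v ≟ x
  ... | yes refl = a , xa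
  ... | no v≢x = Reach⇒neighbour r v≢x

  NoComponentIsClique⇒neighbour : NoComponentIsClique G → ∀ v → ∃[ u ] adj G v u ≡ true
  NoComponentIsClique⇒neighbour noClique v with noClique v
  ... | a , b , ra , rb , a≢b , _ with v ≟ a
  ... | yes refl = Reach⇒neighbour rb a≢b
  ... | no v≢a = Reach⇒neighbour ra v≢a

  isCanonical⇒≤ : ∀ {v w} → isCanonical G v ≡ true → sameCC G v w ≡ true → toℕ v ≤ toℕ w
  isCanonical⇒≤ {v} {w} c v~w = ≤ᵇ⇒≤ (toℕ v) (toℕ w) (≡true⇒T (⇒ᵇ-elim (allF⇒∀ c w) v~w))

-- Charging the cliques of a cover

module Charging {n : ℕ} (G : Graph n) (|A|≡|Ā| : sizeA G ≡ sizeAbar G) where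

  inA⇒isCanonical : ∀ v → inA G v ≡ true → isCanonical G v ≡ true
  inA⇒isCanonical v v∈A = ∧-elimʳ {inA G v} (countF-≡⇒⊇ (λ _ → ∧-elimˡ) |A|≡|Ā| v v∈A)

  inA-adj⇒⊥ : ∀ {v w} → inA G v ≡ true → inA G w ≡ true → adj G v w ≡ true → ⊥
  inA-adj⇒⊥ {v} {w} v∈A w∈A vw = adj⇒≢ G vw (toℕ-injective (≤-antisym
    (isCanonical⇒≤ G (inA⇒isCanonical v v∈A) v~w)
    (isCanonical⇒≤ G (inA⇒isCanonical w w∈A) (sameCC-sym G v~w))))
    where
    v~w : sameCC G v w ≡ true
    v~w = Simplicial-adj⇒sameCC G (inA⇒Simplicial G v v∈A) (inA⇒Simplicial G w w∈A) vw

  inC∩A : Subset n → Fin n → Bool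
  inC∩A C v = lookup C v ∧ inA G v

  IsClique⇒|∩A|≤1 : ∀ {C} → IsClique G C → countF (inC∩A C) ≤ 1
  IsClique⇒|∩A|≤1 {C} cl = countF≤1 unique
    where
    unique : ∀ u v → inC∩A C u ≡ true → inC∩A C v ≡ true → u ≡ v
    unique u v u∈C∩A v∈C∩A with u ≟ v
    ... | yes u≡v = u≡v
    ... | no u≢v = ⊥-elim (inA-adj⇒⊥ (∧-elimʳ {lookup C u} u∈C∩A) (∧-elimʳ {lookup C v} v∈C∩A)
      (cl u v (lookup⇒[]= u C (∧-elimˡ u∈C∩A)) (lookup⇒[]= v C (∧-elimˡ v∈C∩A)) u≢v))

  nontrivial : Subset n → Bool
  nontrivial C = 2 ≤ᵇ ∣ C ∣

  share : Subset n → Fin n → ℕ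
  share C v = 2 * ind (lookup C v) + 2 * ind (inC∩A C v)

  -- Singletons are exempt: a lone vertex of A would be charged 4 > 3 · 1.
  charge : Subset n → Fin n → ℕ
  charge C v = ind (nontrivial C) * share C v

  ∑-share : ∀ C → ∑[ v < n ] share C v ≡ 2 * ∣ C ∣ + 2 * countF (inC∩A C)
  ∑-share C = begin
    ∑[ v < n ] share C v
      ≡⟨ ∑-distrib-+ (λ v → 2 * ind (lookup C v)) (λ v → 2 * ind (inC∩A C v)) ⟩
    (∑[ v < n ] (2 * ind (lookup C v))) + (∑[ v < n ] (2 * ind (inC∩A C v)))
      ≡⟨ cong₂ _+_ (sym (*-distribˡ-sum 2 (ind ∘ lookup C))) (sym (*-distribˡ-sum 2 (ind ∘ inC∩A C))) ⟩
    2 * (∑[ v < n ] ind (lookup C v)) + 2 * (∑[ v < n ] ind (inC∩A C v))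
      ≡⟨ cong₂ (λ a b → 2 * a + 2 * b) (sym (countF≡∑ (lookup C))) (sym (countF≡∑ (inC∩A C))) ⟩
    2 * countF (lookup C) + 2 * countF (inC∩A C)
      ≡⟨ cong (λ a → 2 * a + 2 * countF (inC∩A C)) (sym (∣p∣≡countF C)) ⟩
    2 * ∣ C ∣ + 2 * countF (inC∩A C)
      ∎
    where open ≡-Reasoning

  IsClique⇒∑charge≤ : ∀ C → IsClique G C → ∑[ v < n ] charge C v ≤ 3 * ∣ C ∣
  IsClique⇒∑charge≤ C cl = begin
    ∑[ v < n ] charge C v                        ≡⟨ sym (*-distribˡ-sum (ind (nontrivial C)) (share C)) ⟩
    ind (nontrivial C) * (∑[ v < n ] share C v)  ≤⟨ bound ⟩
    3 * ∣ C ∣                                    ∎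
    where
    open ≤-Reasoning
    bound : ind (nontrivial C) * (∑[ v < n ] share C v) ≤ 3 * ∣ C ∣
    bound with nontrivial C in nt
    ... | false = z≤n
    ... | true = begin
      1 * (∑[ v < n ] share C v)        ≡⟨ *-identityˡ _ ⟩
      ∑[ v < n ] share C v              ≡⟨ ∑-share C ⟩
      2 * ∣ C ∣ + 2 * countF (inC∩A C)  ≤⟨ +-monoʳ-≤ (2 * ∣ C ∣) (*-monoʳ-≤ 2 (IsClique⇒|∩A|≤1 cl)) ⟩
      2 * ∣ C ∣ + 2                     ≤⟨ +-monoʳ-≤ (2 * ∣ C ∣) (≤ᵇ⇒≤ 2 ∣ C ∣ (≡true⇒T nt)) ⟩
      2 * ∣ C ∣ + ∣ C ∣                 ≡⟨ +-comm (2 * ∣ C ∣) ∣ C ∣ ⟩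
      3 * ∣ C ∣                         ∎

  member-charge : ∀ {C u v} → v ∈ C → u ∈ C → v ≢ u → charge C v ≡ 2 + 2 * ind (inA G v)
  member-charge {C} {u} {v} v∈C u∈C v≢u =
    trans (cong₂ (λ a b → ind a * (2 * ind b + 2 * ind (b ∧ inA G v))) nt ([]=⇒lookup v∈C)) (*-identityˡ _)
    where
    nt : nontrivial C ≡ true
    nt = T⇒≡true (≤⇒≤ᵇ (subst (2 ≤_) (sym (∣p∣≡countF C))
      (countF≥2 v u ([]=⇒lookup v∈C) ([]=⇒lookup u∈C) v≢u)))

  module _ (noClique : NoComponentIsClique G) (𝒞 : SigmaCliqueCover G) where

    chargeAt : Fin n → ℕ
    chargeAt v = sum (map (λ C → charge C v) (sets 𝒞))

    inA⇒chargeAt≥4 : ∀ {v} → inA G v ≡ true → 4 ≤ chargeAt v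
    inA⇒chargeAt≥4 {v} v∈A with NoComponentIsClique⇒neighbour G noClique v
    ... | u , vu = ≤-sum-map-Any (λ C → charge C v) (covers 𝒞 v u vu) bound
      where
      bound : ∀ {C} → v ∈ C × u ∈ C → 4 ≤ charge C v
      bound (v∈C , u∈C) = ≤-reflexive (sym (trans (member-charge v∈C u∈C (adj⇒≢ G vu))
                                                    (cong (λ a → 2 + 2 * ind a) v∈A)))

    NonAdjacentNeighbours⇒chargeAt≥4 : ∀ {v} → NonAdjacentNeighbours G v → 4 ≤ chargeAt v
    NonAdjacentNeighbours⇒chargeAt≥4 {v} (y , z , vy , vz , y≢z , y≁z) =
      ≤-sum-map-Any₂ (λ C → charge C v) (cliques 𝒞) (covers 𝒞 v y vy) (covers 𝒞 v z vz)
        disjoint (bound vy) (bound vz)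
      where
      disjoint : ∀ {C} → IsClique G C → v ∈ C × y ∈ C → v ∈ C × z ∈ C → ⊥
      disjoint cl (_ , y∈C) (_ , z∈C) = true≢false (cl y z y∈C z∈C y≢z) y≁z
      bound : ∀ {u C} → adj G v u ≡ true → v ∈ C × u ∈ C → 2 ≤ charge C v
      bound vu (v∈C , u∈C) = ≤-trans (m≤m+n 2 _) (≤-reflexive (sym (member-charge v∈C u∈C (adj⇒≢ G vu))))

    chargeAt≥4 : ∀ v → 4 ≤ chargeAt v
    chargeAt≥4 v with inA G v ≟ᵇ true
    ... | yes v∈A = inA⇒chargeAt≥4 v∈A
    ... | no v∉A = NonAdjacentNeighbours⇒chargeAt≥4 (inA-false⇒NonAdjacentNeighbours G v (¬-not v∉A))

    n*4≤3*weight : n * 4 ≤ 3 * weight G 𝒞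
    n*4≤3*weight = begin
      n * 4                                             ≡⟨ sym (∑-const {n} 4) ⟩
      ∑[ v < n ] 4                                      ≤⟨ ∑-mono-≤ chargeAt≥4 ⟩
      ∑[ v < n ] chargeAt v                             ≡⟨ sym (sum-map-∑-comm (sets 𝒞) charge) ⟩
      sum (map (λ C → ∑[ v < n ] charge C v) (sets 𝒞))  ≤⟨ sum-map-≤-* _ ∣_∣ 3 (cliques 𝒞) (IsClique⇒∑charge≤ _) ⟩
      3 * weight G 𝒞                                    ∎
      where open ≤-Reasoning

lemma8 : ∀ {n : ℕ} (G : Graph n) (k : ℕ)
             → NoComponentIsClique G
             → sizeA G ≡ sizeAbar G
             → 3 * k < n
             → ¬ HasSigmaCliqueCover G (n + k)
lemma8 {n} G k noClique |A|≡|Ā| 3k<n (𝒞 , weight≤n+k) = <-irrefl refl (begin-strict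
  n * 4           ≤⟨ Charging.n*4≤3*weight G |A|≡|Ā| noClique 𝒞 ⟩
  3 * weight G 𝒞  ≤⟨ *-monoʳ-≤ 3 weight≤n+k ⟩
  3 * (n + k)     ≡⟨ *-distribˡ-+ 3 n k ⟩
  3 * n + 3 * k   <⟨ +-monoʳ-< (3 * n) 3k<n ⟩
  3 * n + n       ≡⟨ +-comm (3 * n) n ⟩
  4 * n           ≡⟨ *-comm 4 n ⟩
  n * 4           ∎)
  where open ≤-Reasoning
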